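{- Let $\mathscr{L}$ be a language with semantic structure $\mathcal{S}=(\Sigma,I)$. (1) $P_{\mathscr{L}} = \mathrm{pr}(\mathrm{AD}_{\mathscr{L}})$ and $\mathrm{par}(P_{\mathscr{L}}) = \mathbb{P}(\mathrm{AD}_{\mathscr{L}})$, where $\mathbb{P} = \mathrm{par}\circ\mathrm{pr}$. (2) For $P\in\mathrm{Part}(\Sigma)$: $P$ is strongly preserving for $\mathscr{L}$ iff $P\preceq\mathrm{pr}(\mathrm{AD}_{\mathscr{L}})$ iff $\mathrm{par}(P)\sqsubseteq\mathrm{AD}_{\mathscr{L}}$. (3) If $\mathscr{L}$ is closed under infinite logical conjunction, then $\mathrm{AD}_{\mathscr{L}}$ is partitioning iff $\mathscr{L}$ is closed under logical negation.
   Context: A language $\mathscr{L}$: formulas $\varphi ::= p\mid f(\varphi_1,\dots,\varphi_n)$, $p\in AP$, $f\in Op$ finite, arities $>0$; $\mathcal{S}=(\Sigma,I)$ interprets atoms as subsets of $\Sigma$ and operators as functions on $\wp(\Sigma)$, giving the inductive concrete semantics $[\![\cdot]\!]_{\mathcal{S}}$. $P_{\mathscr{L}}$ is the partition of $\Sigma$ induced by $s\equiv s'\iff\forall\varphi\in\mathscr{L}.\,(s\in[\![\varphi]\!]_{\mathcal{S}}\iff s'\in[\![\varphi]\!]_{\mathcal{S}})$; a partition $P$ is strongly preserving for $\mathscr{L}$ if $P\preceq P_{\mathscr{L}}$, where $P_1\preceq P_2$ iff every block of $P_1$ is contained in a block of $P_2$. Abstract domains of $\wp(\Sigma)_\subseteq$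 are given by Galois insertions $(\alpha,\wp(\Sigma),A,\gamma)$, identified by their closures $\gamma\circ\alpha$ and ordered by $A_1\sqsubseteq A_2$ iff $\gamma_1\alpha_1(S)\subseteq\gamma_2\alpha_2(S)$ for all $S$. $\mathrm{AD}_{\mathscr{L}}$ is the abstract domain whose closure has image the set of all intersections of families of sets $[\![\varphi]\!]_{\mathcal{S}}$ (empty intersection $=\Sigma$). $\mathrm{par}(P)$: the domain $\wp(P)$ with $\alpha_P(S)=\{B\in P\mid B\cap S\neq\varnothing\}$, $\gamma_P(\mathcal{B})=\bigcup\mathcal{B}$; $A$ is partitioning if it equals $\mathrm{par}(P)$ for some $P$. $\mathrm{pr}(A)$: partition into classes of $s\equiv_A s'\iff\alpha(\{s\})=\alpha(\{s'\})$. $\mathscr{L}$ is closed under infinite logical conjunction if for every $\Phi\subseteq\mathscr{L}$ some $\psi$ has $[\![\psi]\!]_{\mathcal{S}}=\bigcap_{\varphi\in\Phi}[\![\varphi]\!]_{\mathcal{S}}$ (with $\bigcap\varnothing=\Sigma$), and closed under logical negation if for every $\varphi$ some $\psi$ has $[\![\psi]\!]_{\mathcal{S}}=\Sigma\setminus[\![\varphi]\!]_{\mathcal{S}}$. -}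

module Defs where

open import Level using (0ℓ)
open import Data.Nat using (ℕ; _<_)
open import Data.Fin using (Fin)
open import Data.Product using (Σ; ∃; ∃-syntax; _×_; _,_)
open import Relation.Binary.Core using (Rel)
open import Relation.Binary.Structures using (IsEquivalence)
open import Relation.Unary using (Pred; _⊆_; _≐_; ｛_｝; ∁; _∈_)
open import Function.Bundles using (_⇔_)

record Language : Set₁ where
  field
    AP       : Set
    nOp      : ℕ
    arity    : Fin nOp → ℕ
    arityPos : (f : Fin nOp) → 0 < arity f

open Language public

data Formula (L : Language) : Set where
  atom : AP L → Formula L
  app  : (f : Fin (nOp L)) → (Fin (arity L f) → Formula L) → Formula L

Subset : Set → Set₁
Subset Σ' = Pred Σ' 0ℓ

record SemStructure (L : Language) (Σ' : Set) : Set₁ where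
  field
    Iatom : AP L → Subset Σ'
    Iop   : (f : Fin (nOp L)) → (Fin (arity L f) → Subset Σ') → Subset Σ'

open SemStructure public

⟦_⟧ : {L : Language} {Σ' : Set} → Formula L → SemStructure L Σ' → Subset Σ'
⟦ atom p ⟧ S = Iatom S p
⟦ app f φs ⟧ S = Iop S f (λ i → ⟦ φs i ⟧ S)

-- Intersection of the family {⟦φ⟧ | φ ∈ Φ} (empty intersection = Σ)
⋂⟦_⟧ : {L : Language} {Σ' : Set} → Pred (Formula L) 0ℓ → SemStructure L Σ' → Subset Σ'
⋂⟦ Φ ⟧ S = λ s → ∀ φ → Φ φ → s ∈ ⟦ φ ⟧ S

-- Partitions are represented by their equivalence relations:
-- the blocks of P are the classes  [u]_P = {t | P u t}.

Block : {Σ' : Set} → Rel Σ' 0ℓ → Σ' → Subset Σ'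
Block P u = λ t → P u t

IsPartition : {Σ' : Set} → Rel Σ' 0ℓ → Set
IsPartition P = IsEquivalence P

_⪯_ : {Σ' : Set} → Rel Σ' 0ℓ → Rel Σ' 0ℓ → Set
_⪯_ {Σ'} P₁ P₂ = (u : Σ') → ∃[ v ] (Block P₁ u ⊆ Block P₂ v)

_≡ₚ_ : {Σ' : Set} → Rel Σ' 0ℓ → Rel Σ' 0ℓ → Set
_≡ₚ_ {Σ'} P₁ P₂ = (s s' : Σ') → P₁ s s' ⇔ P₂ s s'

P-L : {L : Language} {Σ' : Set} → SemStructure L Σ' → Rel Σ' 0ℓ
P-L S s s' = ∀ φ → (s ∈ ⟦ φ ⟧ S) ⇔ (s' ∈ ⟦ φ ⟧ S)

StronglyPreserving : {L : Language} {Σ' : Set} → SemStructure L Σ' → Rel Σ' 0ℓ → Set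
StronglyPreserving S P = P ⪯ P-L S

-- Abstract domains of ℘(Σ)_⊆ are identified with their closures γ∘α.

AbsDom : Set → Set₁
AbsDom Σ' = Subset Σ' → Subset Σ'

_⊑_ : {Σ' : Set} → AbsDom Σ' → AbsDom Σ' → Set₁
A₁ ⊑ A₂ = ∀ X → A₁ X ⊆ A₂ X

_≡ₐ_ : {Σ' : Set} → AbsDom Σ' → AbsDom Σ' → Set₁
A₁ ≡ₐ A₂ = ∀ X → A₁ X ≐ A₂ X

-- AD_L: closure whose image is the Moore family of all intersections
-- of sets ⟦φ⟧; ρ(X) = ⋂ {⟦φ⟧ | X ⊆ ⟦φ⟧}.
AD : {L : Language} {Σ' : Set} → SemStructure L Σ' → AbsDom Σ'
AD S X = ⋂⟦ (λ φ → X ⊆ ⟦ φ ⟧ S) ⟧ S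

-- par(P): γ_P(α_P(X)) = ⋃ {B ∈ P | B ∩ X ≠ ∅}
par : {Σ' : Set} → Rel Σ' 0ℓ → AbsDom Σ'
par P X = λ s → ∃[ u ] (s ∈ Block P u × ∃[ t ] (t ∈ Block P u × t ∈ X))

-- pr(A): s ≡_A s' iff α({s}) = α({s'}), i.e. γα({s}) = γα({s'})
pr : {Σ' : Set} → AbsDom Σ' → Rel Σ' 0ℓ
pr A s s' = A ｛ s ｝ ≐ A ｛ s' ｝

ℙ : {Σ' : Set} → AbsDom Σ' → AbsDom Σ'
ℙ A = par (pr A)

Partitioning : {Σ' : Set} → AbsDom Σ' → Set₁
Partitioning {Σ'} A = Σ (Rel Σ' 0ℓ) (λ P → IsPartition P × (A ≡ₐ par P))

ClosedUnderInfConj : {L : Language} {Σ' : Set} → SemStructure L Σ' → Set₁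
ClosedUnderInfConj {L} S = (Φ : Pred (Formula L) 0ℓ) → ∃[ ψ ] (⟦ ψ ⟧ S ≐ ⋂⟦ Φ ⟧ S)

ClosedUnderNeg : {L : Language} {Σ' : Set} → SemStructure L Σ' → Set
ClosedUnderNeg {L} S = (φ : Formula L) → ∃[ ψ ] (⟦ ψ ⟧ S ≐ ∁ (⟦ φ ⟧ S))

{-# OPTIONS --safe #-}
module Submission where

-- For the closure AD_L, γα({s}) is the set of states satisfying every
-- formula that s satisfies.  Hence α({s}) = α({s'}) iff s and s' have
-- the same theory, i.e. pr(AD_L) = P_L, and (1) and (2) follow because
-- par is monotone with respect to ⪯ and par(P_L) ⊑ AD_L.
--
-- For (3), infinite conjunctions make every AD_L(X) the denotation of a
-- formula.  If AD_L is partitioning, its fixpoints are unions of blocks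
-- and so closed under complement, which yields negation.  Conversely,
-- with negation let χ_s define AD_L({s}); if no element of X were
-- P_L-equivalent to s, then X ⊆ ⟦¬χ_s⟧, so s ∈ AD_L(X) ⊆ ⟦¬χ_s⟧,
-- contradicting s ∈ ⟦χ_s⟧.  Hence AD_L = par(P_L).

open import Defs
open import Level using (0ℓ)
open import Data.Product using (_×_; _,_; proj₁; proj₂; ∃-syntax)
open import Function.Base using (id; _∘_)
open import Function.Bundles using (_⇔_; mk⇔; Equivalence)
open import Function.Construct.Identity using (⇔-id)
open import Function.Construct.Symmetry using (⇔-sym)
open import Function.Construct.Composition using (_⇔-∘_)
open import Axiom.ExcludedMiddle using (ExcludedMiddle)
open import Axiom.DoubleNegationElimination using (DoubleNegationElimination; em⇒dne)
open import Relation.Binary.Core using (Rel)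
open import Relation.Binary.Definitions using (Reflexive)
open import Relation.Binary.Structures using (IsEquivalence)
open import Relation.Binary.PropositionalEquality using (refl)
open import Relation.Unary using (_⊆_; _≐_; ｛_｝; ∁; _∈_)

open Equivalence using (to; from)

module _ {Σ' : Set} where

  private variable
    P P₁ P₂ P₃ : Rel Σ' 0ℓ
    X : Subset Σ'
    s t u : Σ'

  ≡ₚ-sym : P₁ ≡ₚ P₂ → P₂ ≡ₚ P₁
  ≡ₚ-sym P₁≡P₂ s s' = ⇔-sym (P₁≡P₂ s s')

  ≡ₚ⇒⪯ : P₁ ≡ₚ P₂ → P₁ ⪯ P₂
  ≡ₚ⇒⪯ P₁≡P₂ u = u , to (P₁≡P₂ u _)

  ⪯-trans : P₁ ⪯ P₂ → P₂ ⪯ P₃ → P₁ ⪯ P₃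
  ⪯-trans P₁⪯P₂ P₂⪯P₃ u =
    let (v , Bu⊆Bv) = P₁⪯P₂ u
        (w , Bv⊆Bw) = P₂⪯P₃ v
    in w , Bv⊆Bw ∘ Bu⊆Bv

  par-mono : P₁ ⪯ P₂ → par P₁ ⊑ par P₂
  par-mono P₁⪯P₂ X (u , us , t , ut , t∈X) =
    let (v , Bu⊆Bv) = P₁⪯P₂ u in v , Bu⊆Bv us , t , Bu⊆Bv ut , t∈X

  par-cong : P₁ ≡ₚ P₂ → par P₁ ≡ₐ par P₂
  par-cong P₁≡P₂ X = par-mono (≡ₚ⇒⪯ P₁≡P₂) X , par-mono (≡ₚ⇒⪯ (≡ₚ-sym P₁≡P₂)) X

  par-sameBlock : P u s → P u t → s ∈ par P ｛ t ｝
  par-sameBlock us ut = _ , us , _ , ut , refl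

  par-∁-closed : par P X ⊆ X → par P (∁ X) ⊆ ∁ X
  par-∁-closed parX⊆X (u , us , t , ut , t∉X) s∈X = t∉X (parX⊆X (u , ut , _ , us , s∈X))

module _ {L : Language} {Σ' : Set} (S : SemStructure L Σ') where

  private variable
    P : Rel Σ' 0ℓ
    X : Subset Σ'
    s t : Σ'

  P-L-isPartition : IsPartition (P-L S)
  P-L-isPartition = record
    { refl  = λ φ → ⇔-id _
    ; sym   = λ st φ → ⇔-sym (st φ)
    ; trans = λ st tu φ → tu φ ⇔-∘ st φ
    }

  _≼_ : Rel Σ' 0ℓ
  s ≼ t = ∀ φ → s ∈ ⟦ φ ⟧ S → t ∈ ⟦ φ ⟧ S

  ≼⇒P-L : s ≼ t → t ≼ s → P-L S s t
  ≼⇒P-L s≼t t≼s φ = mk⇔ (s≼t φ) (t≼s φ)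

  AD-extensive : X ⊆ AD S X
  AD-extensive s∈X φ X⊆φ = X⊆φ s∈X

  AD-⊆-⟦⟧ : ∀ φ → X ⊆ ⟦ φ ⟧ S → AD S X ⊆ ⟦ φ ⟧ S
  AD-⊆-⟦⟧ φ X⊆φ s∈ADX = s∈ADX φ X⊆φ

  AD-｛｝⇒≼ : t ∈ AD S ｛ s ｝ → s ≼ t
  AD-｛｝⇒≼ t∈ADs φ s∈φ = t∈ADs φ λ { refl → s∈φ }

  ≼⇒AD-｛｝ : s ≼ t → t ∈ AD S ｛ s ｝
  ≼⇒AD-｛｝ s≼t φ s⊆φ = s≼t φ (s⊆φ refl)

  pr-AD⇒P-L : pr (AD S) s t → P-L S s t
  pr-AD⇒P-L {s} {t} (ADs⊆ADt , ADt⊆ADs) =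
    ≼⇒P-L (AD-｛｝⇒≼ (ADt⊆ADs (AD-extensive {｛ t ｝} refl)))
          (AD-｛｝⇒≼ (ADs⊆ADt (AD-extensive {｛ s ｝} refl)))

  P-L⇒pr-AD : P-L S s t → pr (AD S) s t
  P-L⇒pr-AD st =
      (λ u∈ADs → ≼⇒AD-｛｝ λ φ → AD-｛｝⇒≼ u∈ADs φ ∘ from (st φ))
    , (λ u∈ADt → ≼⇒AD-｛｝ λ φ → AD-｛｝⇒≼ u∈ADt φ ∘ to (st φ))

  P-L≡ₚpr-AD : P-L S ≡ₚ pr (AD S)
  P-L≡ₚpr-AD s t = mk⇔ P-L⇒pr-AD pr-AD⇒P-L

  par-P-L⊑AD : par (P-L S) ⊑ AD S
  par-P-L⊑AD X (u , us , t , ut , t∈X) φ X⊆φ = to (us φ) (from (ut φ) (X⊆φ t∈X))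

  ⪯P-L⇔⪯pr-AD : (P ⪯ P-L S) ⇔ (P ⪯ pr (AD S))
  ⪯P-L⇔⪯pr-AD = mk⇔ (λ P⪯ → ⪯-trans P⪯ (≡ₚ⇒⪯ P-L≡ₚpr-AD))
                     (λ P⪯ → ⪯-trans P⪯ (≡ₚ⇒⪯ (≡ₚ-sym P-L≡ₚpr-AD)))

  ⪯P-L⇒par⊑AD : P ⪯ P-L S → par P ⊑ AD S
  ⪯P-L⇒par⊑AD P⪯ X = par-P-L⊑AD X ∘ par-mono P⪯ X

  par⊑AD⇒⪯P-L : Reflexive P → par P ⊑ AD S → P ⪯ P-L S
  par⊑AD⇒⪯P-L P-refl par⊑AD u = u , λ ut → ≼⇒P-L
    (AD-｛｝⇒≼ (par⊑AD ｛ u ｝ (par-sameBlock ut P-refl)))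
    (AD-｛｝⇒≼ (par⊑AD _ (par-sameBlock P-refl ut)))

  AD-definable : ClosedUnderInfConj S → (X : Subset Σ') → ∃[ ψ ] (⟦ ψ ⟧ S ≐ AD S X)
  AD-definable conj X = conj (λ φ → X ⊆ ⟦ φ ⟧ S)

  partitioning⇒closedUnderNeg : ClosedUnderInfConj S → Partitioning (AD S) → ClosedUnderNeg S
  partitioning⇒closedUnderNeg conj (P , _ , AD≡par) φ =
    let (ψ , ψ≐AD) = AD-definable conj (∁ (⟦ φ ⟧ S)) in
    ψ , (∁φ-closed ∘ proj₁ (AD≡par _) ∘ proj₁ ψ≐AD) , (proj₂ ψ≐AD ∘ AD-extensive)
    where
    ∁φ-closed : par P (∁ (⟦ φ ⟧ S)) ⊆ ∁ (⟦ φ ⟧ S)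
    ∁φ-closed = par-∁-closed (AD-⊆-⟦⟧ φ id ∘ proj₂ (AD≡par _))

  module _ (dne : DoubleNegationElimination 0ℓ) (neg : ClosedUnderNeg S) where

    ≼-sym : s ≼ t → t ≼ s
    ≼-sym s≼t φ t∈φ = dne λ s∉φ →
      let (ψ , ψ≐∁φ) = neg φ in proj₁ ψ≐∁φ (s≼t ψ (proj₂ ψ≐∁φ s∉φ)) t∈φ

    AD-｛｝⇒P-L : t ∈ AD S ｛ s ｝ → P-L S t s
    AD-｛｝⇒P-L t∈ADs = let s≼t = AD-｛｝⇒≼ t∈ADs in ≼⇒P-L (≼-sym s≼t) s≼t

    AD⊆par-P-L : ClosedUnderInfConj S → AD S X ⊆ par (P-L S) X
    AD⊆par-P-L {X} conj {s} s∈ADX = dne λ s∉par →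
      let (χ , χ≐ADs) = AD-definable conj ｛ s ｝
          (χᶜ , χᶜ≐∁χ) = neg χ
          X⊆χᶜ : X ⊆ ⟦ χᶜ ⟧ S
          X⊆χᶜ {t} t∈X = proj₂ χᶜ≐∁χ λ t∈χ →
            s∉par (t , AD-｛｝⇒P-L (proj₁ χ≐ADs t∈χ) , t , IsEquivalence.refl P-L-isPartition , t∈X)
      in proj₁ χᶜ≐∁χ (AD-⊆-⟦⟧ χᶜ X⊆χᶜ s∈ADX) (proj₂ χ≐ADs (AD-extensive {｛ s ｝} refl))

    closedUnderNeg⇒partitioning : ClosedUnderInfConj S → Partitioning (AD S)
    closedUnderNeg⇒partitioning conj =
      P-L S , P-L-isPartition , λ X → AD⊆par-P-L conj , par-P-L⊑AD X

proposition5p10 : ExcludedMiddle 0ℓ → (L : Language) → (Σ' : Set) → (S : SemStructure L Σ') →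
    ((P-L S ≡ₚ pr (AD S)) × (par (P-L S) ≡ₐ ℙ (AD S)))
    × ((P : Rel Σ' 0ℓ) → IsPartition P →
         (StronglyPreserving S P ⇔ (P ⪯ pr (AD S)))
         × ((P ⪯ pr (AD S)) ⇔ (par P ⊑ AD S)))
    × (ClosedUnderInfConj S → (Partitioning (AD S) ⇔ ClosedUnderNeg S))
proposition5p10 em L Σ' S =
    (P-L≡ₚpr-AD S , par-cong (P-L≡ₚpr-AD S))
  , (λ P P-isPartition →
        ⪯P-L⇔⪯pr-AD S
      , mk⇔ (⪯P-L⇒par⊑AD S) (par⊑AD⇒⪯P-L S (IsEquivalence.refl P-isPartition))
          ⇔-∘ ⇔-sym (⪯P-L⇔⪯pr-AD S))
  , λ conj → mk⇔ (partitioning⇒closedUnderNeg S conj)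
                 (λ neg → closedUnderNeg⇒partitioning S (em⇒dne em) neg conj)
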